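{- Let $G$ be a finite abelian group of order $n$, let $L$ be a $d$-dimensional Latin hypercube of order $n$ indexed by $G$, let $d'>d$, and let $L'$ be the $d'$-dimensional $G$-extension of $L$. If the entries of $L$ can be partitioned into $(G,d')$-suitable diagonals, then the entries of $L'$ can be partitioned into transversals.
   Context: A $d$-dimensional hypercube of order $n$ indexed by $G$ is a map $H:G^d\to G$ with entries $(x_1,\dots,x_d;H(x_1,\dots,x_d))$; it is Latin if each line (set of entries obtained by fixing all but one coordinate) contains every element of $G$ as a symbol. A diagonal is a set of $n$ entries no two agreeing in any coordinate; a transversal is a diagonal with pairwise distinct symbols. For an entry $e=(x_1,\dots,x_d;\sigma)$, $\Delta(e)=\sigma-x_1-\cdots-x_d$; $G_+$ is the sum of all elements of $G$. A diagonal $D$ of $L$ is $(G,d')$-suitable if $\sum_{e\in D}\Delta(e)=(1-d')G_+$. The $d'$-dimensional $G$-extension of $L$ is the hypercube $L'(x_1,\dots,x_{d'})=L(x_1,\dots,x_d)+\sum_{i=d+1}^{d'}x_i$. -}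

module Defs where

open import Data.Nat using (ℕ; zero; suc; _∸_; _≤_)
open import Data.Fin using (Fin; inject≤)
open import Data.Vec using (Vec; lookup; _[_]≔_; toList)
import Data.Vec as V
open import Data.List using (List; foldr; drop)
import Data.List as L
open import Data.Product using (∃; ∃!; _×_)
open import Relation.Binary.PropositionalEquality using (_≡_)
open import Function.Definitions using (Injective)
open import Algebra.Core using (Op₁; Op₂)
import Algebra.Structures

record FinAbGroup (n : ℕ) : Set where
  infixl 6 _+_
  field
    _+_ : Op₂ (Fin n)
    ε   : Fin n
    -_  : Op₁ (Fin n)
    isAbelianGroup : Algebra.Structures.IsAbelianGroup (_≡_ {A = Fin n}) _+_ ε -_

module _ {n : ℕ} (G : FinAbGroup n) where
  open FinAbGroup G

  ΣG : List (Fin n) → Fin n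
  ΣG = foldr _+_ ε

  G₊ : Fin n
  G₊ = ΣG (L.allFin n)

  _·_ : ℕ → Fin n → Fin n
  zero · g = ε
  suc k · g = g + (k · g)

  Pos : ℕ → Set
  Pos d = Vec (Fin n) d

  Hypercube : ℕ → Set
  Hypercube d = Pos d → Fin n

  IsLatin : ∀ {d} → Hypercube d → Set
  IsLatin {d} H = ∀ (x : Pos d) (i : Fin d) (s : Fin n) → ∃ λ a → H (x [ i ]≔ a) ≡ s

  Δ : ∀ {d} → Pos d → Fin n → Fin n
  Δ x σ = σ + - ΣG (toList x)

  -- A diagonal: n distinct entries (given by their positions, the symbol
  -- being determined by the hypercube), no two agreeing in any coordinate.
  record Diagonal (d : ℕ) : Set where
    field
      pos      : Fin n → Pos d
      distinct : Injective _≡_ _≡_ pos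
      coordInj : ∀ (i : Fin d) → Injective _≡_ _≡_ (λ k → lookup (pos k) i)
  open Diagonal public

  IsTransversal : ∀ {d} → Hypercube d → Diagonal d → Set
  IsTransversal H D = Injective _≡_ _≡_ (λ k → H (pos D k))

  -- (G,d')-suitable: Σ_{e ∈ D} Δ(e) = (1 - d') G₊  (for d' ≥ 1 this is -((d'-1) G₊))
  IsSuitable : ∀ {d} → ℕ → Hypercube d → Diagonal d → Set
  IsSuitable d' H D =
    ΣG (L.tabulate (λ k → Δ (pos D k) (H (pos D k)))) ≡ - ((d' ∸ 1) · G₊)

  IsPartition : ∀ {d m} → (Fin m → Diagonal d) → Set
  IsPartition {d} {m} Ds =
    ∀ (x : Pos d) → ∃! _≡_ (λ (j : Fin m) → ∃ λ k → pos (Ds j) k ≡ x)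

  extension : ∀ {d d'} → d ≤ d' → Hypercube d → Hypercube d'
  extension {d} le H x =
    H (V.tabulate (λ i → lookup x (inject≤ i le))) + ΣG (drop d (toList x))

{-# OPTIONS --safe #-}
module Submission where

-- Write d' = d + 1 + e.  Along a diagonal D of L with positions P k and
-- symbols σ k, the coordinates of P run through G once each, so
-- suitability of D says exactly that a k = σ k + e·k sums to 0.  By Hall's
-- theorem a = β - γ for permutations β, γ of G, and then the positions
-- P k ++ (γ k, k, …, k) form a transversal of L', its symbols being β k.
-- Translating the last 1 + e coordinates by v ∈ G^(1+e) shifts every symbol
-- by Σ v, so it gives again a transversal; over all diagonals of the
-- partition and all v these transversals partition G^d'.
--
-- Hall's theorem is proved by induction on the support of a: changing two
-- entries of a without changing their sum is absorbed by an alternating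
-- chain that modifies β and γ by transpositions.

open import Defs
open import Data.Nat using (ℕ; _<_)
open import Data.Nat.Properties using (<⇒≤)
open import Data.Fin using (Fin)
open import Data.Product using (∃; ∃-syntax; _×_)

open import Level using (0ℓ)
open import Algebra.Bundles using (AbelianGroup)
open import Data.Empty using (⊥-elim)
open import Data.Fin as Fin using (zero; suc; toℕ; fromℕ<; inject≤; punchOut)
open import Data.Fin.Permutation using (permutation)
import Data.Fin.Permutation.Components as PC
open import Data.Fin.Properties
  using (_≟_; any?; punchOut-injective; injective⇒≤; toℕ-injective; toℕ-fromℕ<; toℕ<n; *↔×)
open import Data.Fin.Subset using (Subset; _∈_; _∉_; _⊆_; _⊂_)
open import Data.Fin.Subset.Induction using (Acc; acc; ⊂-wellFounded)
import Data.List as List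
open import Data.Nat as ℕ using (zero; suc; _≤_; _^_)
import Data.Nat.Properties as ℕ
open import Data.Product using (_,_; proj₁; proj₂; ∃!)
open import Data.Product.Function.NonDependent.Propositional using (_×-↔_)
open import Data.Sum using (_⊎_; inj₁; inj₂; [_,_]′)
open import Data.Vec as Vec using (Vec; []; _∷_; lookup; toList; _++_; zipWith; replicate)
import Data.Vec.Properties as Vec
open import Data.Vec.Functional using (updateAt)
open import Data.Vec.Functional.Properties using (updateAt-updates; updateAt-minimal)
open import Data.Vec.Recursive using (Fin[m^n]↔Fin[m]^n)
open import Data.Vec.Recursive.Properties using (↔Vec)
open import Function using (_∘_; id; const; case_of_; _↔_; Inverse)
open import Function.Definitions using (Injective)
open import Function.Properties.Inverse using (↔-refl; ↔-trans)
open import Relation.Binary.PropositionalEquality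
open import Relation.Nullary using (yes; no; does)
open import Relation.Nullary.Decidable using (dec-true; dec-false)

-- Self-maps of finite sets

injective⇒surjective : ∀ {n} {f : Fin n → Fin n} → Injective _≡_ _≡_ f → ∀ y → ∃ λ x → f x ≡ y
injective⇒surjective {zero}      _     ()
injective⇒surjective {suc n} {f} f-inj y with any? (λ x → f x ≟ y)
... | yes hit = hit
... | no miss = ⊥-elim (ℕ.<-irrefl refl (injective⇒≤ punchOut∘f-injective))
  where
  y≢f : ∀ x → y ≢ f x
  y≢f x y≡fx = miss (x , sym y≡fx)
  punchOut∘f-injective : Injective _≡_ _≡_ (λ x → punchOut (y≢f x))
  punchOut∘f-injective eq = f-inj (punchOut-injective (y≢f _) (y≢f _) eq)

transpose-matchˡ : ∀ {n} (i j : Fin n) → PC.transpose i j i ≡ j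
transpose-matchˡ i j rewrite dec-true (i ≟ i) refl = refl

transpose-matchʳ : ∀ {n} (i j : Fin n) → PC.transpose i j j ≡ i
transpose-matchʳ i j with j ≟ i
... | yes j≡i = j≡i
... | no _ rewrite dec-true (j ≟ j) refl = refl

transpose-mismatch : ∀ {n} {i j k : Fin n} → k ≢ i → k ≢ j → PC.transpose i j k ≡ k
transpose-mismatch {i = i} {j} {k} k≢i k≢j rewrite dec-false (k ≟ i) k≢i | dec-false (k ≟ j) k≢j = refl

transpose-injective : ∀ {n} (i j : Fin n) → Injective _≡_ _≡_ (PC.transpose i j)
transpose-injective i j eq =
  trans (sym (PC.transpose-inverse j i)) (trans (cong (PC.transpose j i) eq) (PC.transpose-inverse j i))

agreement : ∀ {n m} → (Fin n → Fin m) → (Fin n → Fin m) → Subset n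
agreement f g = Vec.tabulate (λ i → does (f i ≟ g i))

agreement⁺ : ∀ {n m} (f g : Fin n → Fin m) {i} → f i ≡ g i → i ∈ agreement f g
agreement⁺ f g {i} fi≡gi =
  Vec.lookup⇒[]= i _ (trans (Vec.lookup∘tabulate _ i) (dec-true (f i ≟ g i) fi≡gi))

agreement⁻ : ∀ {n m} (f g : Fin n → Fin m) {i} → i ∈ agreement f g → f i ≡ g i
agreement⁻ f g {i} i∈ with f i ≟ g i | trans (sym (Vec.lookup∘tabulate _ i)) (Vec.[]=⇒lookup i∈)
... | yes fi≡gi | _ = fi≡gi

-- Sums in a finite abelian group

module FinAbGroupProperties {n} (G : FinAbGroup n) where
  open FinAbGroup G public

  abelianGroup : AbelianGroup 0ℓ 0ℓ
  abelianGroup = record { isAbelianGroup = isAbelianGroup }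

  open AbelianGroup abelianGroup public
    using (assoc; comm; identityˡ; identityʳ; inverseˡ; commutativeMonoid; monoid)
  open import Algebra.Properties.AbelianGroup abelianGroup public
    using (∙-cancelˡ; ∙-cancelʳ; //-rightDividesˡ; \\-leftDividesˡ)
  open import Algebra.Properties.CommutativeMonoid.Sum commutativeMonoid public
    using (sum; sum-cong-≗; ∑-comm; ∑-distrib-+; sum-permute; sum-replicate; sum-replicate-zero)
  open import Algebra.Properties.Monoid.Mult monoid public using (×-homo-+) renaming (_×_ to _×ᴳ_)
  open import Algebra.Solver.CommutativeMonoid commutativeMonoid public using (solve; _⊕_; _⊜_)
  open ≡-Reasoning

  ·≗×ᴳ : ∀ k g → _·_ G k g ≡ k ×ᴳ g
  ·≗×ᴳ zero    g = refl
  ·≗×ᴳ (suc k) g = cong (g +_) (·≗×ᴳ k g)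

  ΣG-toList : ∀ {k} (v : Vec (Fin n) k) → ΣG G (toList v) ≡ sum (lookup v)
  ΣG-toList []      = refl
  ΣG-toList (x ∷ v) = cong (x +_) (ΣG-toList v)

  ΣG-tabulate : ∀ {k} (f : Fin k → Fin n) → ΣG G (List.tabulate f) ≡ sum f
  ΣG-tabulate {zero}  f = refl
  ΣG-tabulate {suc k} f = cong (f zero +_) (ΣG-tabulate (f ∘ suc))

  ΣG-zipWith : ∀ {k} (u v : Vec (Fin n) k) →
               ΣG G (toList (zipWith _+_ u v)) ≡ ΣG G (toList u) + ΣG G (toList v)
  ΣG-zipWith []      []      = sym (identityˡ ε)
  ΣG-zipWith (x ∷ u) (y ∷ v) = trans (cong (x + y +_) (ΣG-zipWith u v))
    (solve 4 (λ a b c d → (a ⊕ b) ⊕ (c ⊕ d) ⊜ (a ⊕ c) ⊕ (b ⊕ d)) refl x y _ _)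

  sum-injective : ∀ {f : Fin n → Fin n} → Injective _≡_ _≡_ f → sum f ≡ G₊ G
  sum-injective {f} f-inj = begin
    sum f   ≡⟨ sum-permute id π ⟨
    sum id  ≡⟨ ΣG-tabulate id ⟨
    G₊ G    ∎
    where
    f-surj = injective⇒surjective f-inj
    π = permutation f (proj₁ ∘ f-surj) (proj₂ ∘ f-surj) (λ x → f-inj (proj₂ (f-surj (f x))))

  sum-coordinateSums : ∀ {m} (P : Fin n → Vec (Fin n) m) →
                       (∀ i → Injective _≡_ _≡_ (λ k → lookup (P k) i)) →
                       sum (λ k → ΣG G (toList (P k))) ≡ m ×ᴳ G₊ G
  sum-coordinateSums {m} P P-injective = begin
    sum (λ k → ΣG G (toList (P k)))         ≡⟨ sum-cong-≗ (ΣG-toList ∘ P) ⟩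
    sum (λ k → sum (lookup (P k)))          ≡⟨ ∑-comm (lookup ∘ P) ⟩
    sum (λ i → sum (λ k → lookup (P k) i))  ≡⟨ sum-cong-≗ (sum-injective ∘ P-injective) ⟩
    sum {m} (const (G₊ G))                  ≡⟨ sum-replicate m ⟩
    m ×ᴳ G₊ G                               ∎

  sum-clear : ∀ {k} (f : Fin k → Fin n) i → sum f ≡ f i + sum (updateAt f i (const ε))
  sum-clear f zero    = cong (f zero +_) (sym (identityˡ _))
  sum-clear f (suc i) = trans (cong (f zero +_) (sum-clear (f ∘ suc) i))
    (solve 3 (λ a b c → a ⊕ (b ⊕ c) ⊜ b ⊕ (a ⊕ c)) refl (f zero) (f (suc i)) _)

-- Hall's theorem

module _ {n} (G : FinAbGroup n) where
  open FinAbGroupProperties G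

  record DifferenceOfPermutations (A : Fin n → Fin n) : Set where
    field
      β γ         : Fin n → Fin n
      β-injective : Injective _≡_ _≡_ β
      γ-injective : Injective _≡_ _≡_ γ
      β≡γ+A       : ∀ i → β i ≡ γ i + A i

  -- Indices other than j and q are balanced, and j and q are
  -- balanced jointly with a conserved total K.  A step swaps β at j and
  -- k = β⁻¹ (γ j + A j) and γ at k and q, which balances j and makes k the new
  -- defect.  Moved indices (γ i ≢ γ⁰ i) satisfy β i + γ⁰ i ≡ K; this forces k
  -- to be unmoved, so the set of unmoved indices shrinks at every step.
  module ExchangeChain (A : Fin n → Fin n) (q K : Fin n)
                       (γ⁰ : Fin n → Fin n) (γ⁰-injective : Injective _≡_ _≡_ γ⁰) where

    record State : Set where
      field
        β γ         : Fin n → Fin n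
        β-injective : Injective _≡_ _≡_ β
        γ-injective : Injective _≡_ _≡_ γ
        j           : Fin n
        j≢q         : j ≢ q
        β≡γ+A       : ∀ i → i ≢ j → i ≢ q → β i ≡ γ i + A i
        γ-sum       : γ j + A j + γ q ≡ K
        β-sum       : β j + β q ≡ K + A q
        γq-origin   : γ q ≡ γ⁰ j ⊎ γ q ≡ γ⁰ q
        γj-moved    : γ j ≢ γ⁰ j → γ q ≡ γ⁰ j
        β-moved     : ∀ i → i ≢ j → i ≢ q → γ i ≢ γ⁰ i → β i + γ⁰ i ≡ K

    unmoved : State → Subset n
    unmoved s = agreement (State.γ s) γ⁰

    module Step (s : State) where
      open State s
      open ≡-Reasoning

      target : Fin n
      target = γ j + A j

      pair-sum : ∀ {x} → β x ≡ target → β j + β q ≡ β x + (γ q + A q)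
      pair-sum {x} βx≡target = begin
        β j + β q           ≡⟨ β-sum ⟩
        K + A q             ≡⟨ cong (_+ A q) γ-sum ⟨
        target + γ q + A q  ≡⟨ cong (λ z → z + γ q + A q) βx≡target ⟨
        β x + γ q + A q     ≡⟨ assoc _ _ _ ⟩
        β x + (γ q + A q)   ∎

      solved-at-j : β j ≡ target → DifferenceOfPermutations A
      solved-at-j βj≡target = record
        { β = β ; γ = γ ; β-injective = β-injective ; γ-injective = γ-injective ; β≡γ+A = balanced }
        where
        balanced : ∀ i → β i ≡ γ i + A i
        balanced i with i ≟ j | i ≟ q
        ... | yes refl | _        = βj≡target
        ... | no _     | yes refl = ∙-cancelˡ (β j) _ _ (pair-sum βj≡target)
        ... | no i≢j   | no i≢q   = β≡γ+A i i≢j i≢q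

      solved-by-swap : β q ≡ target → DifferenceOfPermutations A
      solved-by-swap βq≡target = record
        { β = β ∘ PC.transpose j q ; γ = γ
        ; β-injective = λ eq → transpose-injective j q (β-injective eq)
        ; γ-injective = γ-injective ; β≡γ+A = balanced }
        where
        -- Not 'with i ≟ j': that would also abstract the test inside PC.transpose j q i.
        balanced : ∀ i → β (PC.transpose j q i) ≡ γ i + A i
        balanced i = case ((i ≟ j) , (i ≟ q)) of λ
          { (yes refl , _)      → trans (cong β (transpose-matchˡ j q)) βq≡target
          ; (no _ , yes refl)   → trans (cong β (transpose-matchʳ j q))
                                    (∙-cancelˡ (β q) _ _ (trans (comm _ _) (pair-sum βq≡target)))
          ; (no i≢j , no i≢q)   → trans (cong β (transpose-mismatch i≢j i≢q)) (β≡γ+A i i≢j i≢q) }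

      module Advance {k} (βk≡target : β k ≡ target) (k≢j : k ≢ j) (k≢q : k ≢ q) where

        γk-unmoved : γ k ≡ γ⁰ k
        γk-unmoved with γ k ≟ γ⁰ k
        ... | yes γk≡γ⁰k = γk≡γ⁰k
        ... | no moved   =
          ⊥-elim ([ k≢j ∘ γ⁰-injective ∘ trans γ⁰k≡γq
                  , k≢q ∘ γ⁰-injective ∘ trans γ⁰k≡γq ]′ γq-origin)
          where
          γ⁰k≡γq : γ⁰ k ≡ γ q
          γ⁰k≡γq = ∙-cancelˡ target _ _ (begin
            target + γ⁰ k  ≡⟨ cong (_+ γ⁰ k) βk≡target ⟨
            β k + γ⁰ k     ≡⟨ β-moved k k≢j k≢q moved ⟩
            K              ≡⟨ γ-sum ⟨
            target + γ q   ∎)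

        β′ γ′ : Fin n → Fin n
        β′ = β ∘ PC.transpose j k
        γ′ = γ ∘ PC.transpose k q

        β′j≡target : β′ j ≡ target
        β′j≡target = trans (cong β (transpose-matchˡ j k)) βk≡target

        β′-other : ∀ {i} → i ≢ j → i ≢ k → β′ i ≡ β i
        β′-other i≢j i≢k = cong β (transpose-mismatch i≢j i≢k)

        γ′-other : ∀ {i} → i ≢ k → i ≢ q → γ′ i ≡ γ i
        γ′-other i≢k i≢q = cong γ (transpose-mismatch i≢k i≢q)

        γ′q≡γ⁰k : γ′ q ≡ γ⁰ k
        γ′q≡γ⁰k = trans (cong γ (transpose-matchʳ k q)) γk-unmoved

        β′≡γ′+A : ∀ i → i ≢ k → i ≢ q → β′ i ≡ γ′ i + A i
        β′≡γ′+A i i≢k i≢q = case i ≟ j of λ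
          { (yes refl) → trans β′j≡target (cong (_+ A i) (sym (γ′-other i≢k i≢q)))
          ; (no i≢j)   → trans (β′-other i≢j i≢k)
                           (trans (β≡γ+A i i≢j i≢q) (cong (_+ A i) (sym (γ′-other i≢k i≢q)))) }

        γ′-sum : γ′ k + A k + γ′ q ≡ K
        γ′-sum = begin
          γ′ k + A k + γ′ q  ≡⟨ cong₂ (λ u v → u + A k + v) (cong γ (transpose-matchˡ k q))
                                                             (cong γ (transpose-matchʳ k q)) ⟩
          γ q + A k + γ k    ≡⟨ solve 3 (λ x y z → (x ⊕ y) ⊕ z ⊜ (z ⊕ y) ⊕ x) refl (γ q) (A k) (γ k) ⟩
          γ k + A k + γ q    ≡⟨ cong (_+ γ q) (β≡γ+A k k≢j k≢q) ⟨
          β k + γ q          ≡⟨ cong (_+ γ q) βk≡target ⟩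
          target + γ q       ≡⟨ γ-sum ⟩
          K                  ∎

        β′-sum : β′ k + β′ q ≡ K + A q
        β′-sum = trans (cong₂ _+_ (cong β (transpose-matchʳ j k)) (β′-other (j≢q ∘ sym) (k≢q ∘ sym)))
                       β-sum

        β′-moved : ∀ i → i ≢ k → i ≢ q → γ′ i ≢ γ⁰ i → β′ i + γ⁰ i ≡ K
        β′-moved i i≢k i≢q moved′ = case i ≟ j of λ
          { (yes refl) → trans (cong₂ _+_ β′j≡target
                                       (sym (γj-moved (moved′ ∘ trans (γ′-other i≢k i≢q)))))
                               γ-sum
          ; (no i≢j)   → trans (cong (_+ γ⁰ i) (β′-other i≢j i≢k))
                           (β-moved i i≢j i≢q (moved′ ∘ trans (γ′-other i≢k i≢q))) }

        next : State
        next = record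
          { β = β′ ; γ = γ′
          ; β-injective = λ eq → transpose-injective j k (β-injective eq)
          ; γ-injective = λ eq → transpose-injective k q (γ-injective eq)
          ; j = k ; j≢q = k≢q
          ; β≡γ+A = β′≡γ′+A ; γ-sum = γ′-sum ; β-sum = β′-sum
          ; γq-origin = inj₁ γ′q≡γ⁰k ; γj-moved = const γ′q≡γ⁰k ; β-moved = β′-moved }

        k∉unmoved-next : k ∉ unmoved next
        k∉unmoved-next k∈ =
          k≢q (γ-injective (trans γk-unmoved
                               (trans (sym (agreement⁻ γ′ γ⁰ k∈)) (cong γ (transpose-matchˡ k q)))))

        next-shrinks : unmoved next ⊂ unmoved s
        next-shrinks = unmoved-next⊆ , k , agreement⁺ γ γ⁰ γk-unmoved , k∉unmoved-next
          where
          unmoved-next⊆ : unmoved next ⊆ unmoved s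
          unmoved-next⊆ {i} i∈ = case ((i ≟ k) , (i ≟ q)) of λ
            { (yes refl , _)    → ⊥-elim (k∉unmoved-next i∈)
            ; (no _ , yes refl) →
                ⊥-elim (k≢q (γ⁰-injective (trans (sym γ′q≡γ⁰k) (agreement⁻ γ′ γ⁰ i∈))))
            ; (no i≢k , no i≢q) →
                agreement⁺ γ γ⁰ (trans (sym (γ′-other i≢k i≢q)) (agreement⁻ γ′ γ⁰ i∈)) }

      step : ((s′ : State) → unmoved s′ ⊂ unmoved s → DifferenceOfPermutations A) →
             DifferenceOfPermutations A
      step continue with β j ≟ target | β q ≟ target
      ... | yes βj≡target | _             = solved-at-j βj≡target
      ... | no _          | yes βq≡target = solved-by-swap βq≡target
      ... | no βj≢target  | no βq≢target  = continue next next-shrinks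
        where
        k = proj₁ (injective⇒surjective β-injective target)
        βk≡target = proj₂ (injective⇒surjective β-injective target)
        open Advance βk≡target (λ k≡j → βj≢target (subst (λ x → β x ≡ target) k≡j βk≡target))
                               (λ k≡q → βq≢target (subst (λ x → β x ≡ target) k≡q βk≡target))

    run : (s : State) → Acc _⊂_ (unmoved s) → DifferenceOfPermutations A
    run s (acc more) = Step.step s (λ s′ s′⊂s → run s′ (more s′⊂s))

  exchange : ∀ {A A′ : Fin n → Fin n} → DifferenceOfPermutations A → ∀ {p q} → p ≢ q →
             (∀ i → i ≢ p → i ≢ q → A′ i ≡ A i) → A′ p + A′ q ≡ A p + A q →
             DifferenceOfPermutations A′
  exchange {A} {A′} δ {p} {q} p≢q same-elsewhere same-sum = run initial (⊂-wellFounded _)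
    where
    open DifferenceOfPermutations δ
    K = γ p + A′ p + γ q
    open ExchangeChain A′ q K γ γ-injective
    open ≡-Reasoning

    initial : State
    initial = record
      { β = β ; γ = γ ; β-injective = β-injective ; γ-injective = γ-injective
      ; j = p ; j≢q = p≢q
      ; β≡γ+A = λ i i≢p i≢q → trans (β≡γ+A i) (cong (γ i +_) (sym (same-elsewhere i i≢p i≢q)))
      ; γ-sum = refl
      ; β-sum = begin
          β p + β q                    ≡⟨ cong₂ _+_ (β≡γ+A p) (β≡γ+A q) ⟩
          (γ p + A p) + (γ q + A q)    ≡⟨ solve 4 (λ a b c d → (a ⊕ b) ⊕ (c ⊕ d) ⊜ (a ⊕ c) ⊕ (b ⊕ d))
                                                refl (γ p) (A p) (γ q) (A q) ⟩
          (γ p + γ q) + (A p + A q)    ≡⟨ cong ((γ p + γ q) +_) same-sum ⟨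
          (γ p + γ q) + (A′ p + A′ q)  ≡⟨ solve 4 (λ a b c d → (a ⊕ c) ⊕ (b ⊕ d) ⊜ ((a ⊕ b) ⊕ c) ⊕ d)
                                                refl (γ p) (A′ p) (γ q) (A′ q) ⟩
          K + A′ q                     ∎
      ; γq-origin = inj₂ refl
      ; γj-moved = λ moved → ⊥-elim (moved refl)
      ; β-moved = λ _ _ _ moved → ⊥-elim (moved refl) }

-- The entry of A at suc r is folded into A zero, and restored by an exchange.
module HallInduction {m} (G : FinAbGroup (suc m)) where
  open FinAbGroupProperties G
  open ≡-Reasoning

  hall-vanishing : ∀ r → r ≤ m → ∀ (A : Fin (suc m) → Fin (suc m)) →
                   (∀ (i : Fin m) → r ≤ toℕ i → A (suc i) ≡ ε) → sum A ≡ ε →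
                   DifferenceOfPermutations G A
  hall-vanishing zero _ A vanish ΣA≡ε = record
    { β = id ; γ = id ; β-injective = id ; γ-injective = id ; β≡γ+A = i≡i+Ai }
    where
    A0≡ε : A zero ≡ ε
    A0≡ε = begin
      A zero                  ≡⟨ identityʳ _ ⟨
      A zero + ε              ≡⟨ cong (A zero +_) (trans (sum-cong-≗ (λ i → vanish i ℕ.z≤n))
                                                          (sum-replicate-zero m)) ⟨
      A zero + sum (A ∘ suc)  ≡⟨ ΣA≡ε ⟩
      ε                       ∎
    i≡i+Ai : ∀ i → i ≡ i + A i
    i≡i+Ai zero    = sym (trans (cong (zero +_) A0≡ε) (identityʳ _))
    i≡i+Ai (suc i) = sym (trans (cong (suc i +_) (vanish i ℕ.z≤n)) (identityʳ _))
  hall-vanishing (suc r) r<m A vanish ΣA≡ε =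
    exchange G (hall-vanishing r (ℕ.<⇒≤ r<m) Â Â-vanish ΣÂ≡ε) {p} {zero} (λ ()) A≡Â-elsewhere same-sum
    where
    r′ : Fin m
    r′ = fromℕ< r<m
    p : Fin (suc m)
    p = suc r′
    Â : Fin (suc m) → Fin (suc m)
    Â zero    = A zero + A p
    Â (suc i) = updateAt (A ∘ suc) r′ (const ε) i

    Â-vanish : ∀ i → r ≤ toℕ i → Â (suc i) ≡ ε
    Â-vanish i r≤i with i ≟ r′
    ... | yes refl = updateAt-updates r′ (A ∘ suc)
    ... | no i≢r′  = trans (updateAt-minimal i r′ (A ∘ suc) i≢r′) (vanish i (ℕ.≤∧≢⇒< r≤i r≢i))
      where
      r≢i : r ≢ toℕ i
      r≢i r≡i = i≢r′ (toℕ-injective (trans (sym r≡i) (sym (toℕ-fromℕ< r<m))))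

    ΣÂ≡ε : sum Â ≡ ε
    ΣÂ≡ε = trans (assoc _ _ _) (trans (cong (A zero +_) (sym (sum-clear (A ∘ suc) r′))) ΣA≡ε)

    A≡Â-elsewhere : ∀ i → i ≢ p → i ≢ zero → A i ≡ Â i
    A≡Â-elsewhere zero    _   i≢0 = ⊥-elim (i≢0 refl)
    A≡Â-elsewhere (suc i) i≢p _   = sym (updateAt-minimal i r′ (A ∘ suc) (i≢p ∘ cong suc))

    same-sum : A p + A zero ≡ Â p + Â zero
    same-sum = sym (begin
      Â p + Â zero        ≡⟨ cong (_+ Â zero) (updateAt-updates r′ (A ∘ suc)) ⟩
      ε + (A zero + A p)  ≡⟨ identityˡ _ ⟩
      A zero + A p        ≡⟨ comm _ _ ⟩
      A p + A zero        ∎)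

hall : ∀ {n} (G : FinAbGroup n) (A : Fin n → Fin n) →
       let open FinAbGroupProperties G in sum A ≡ ε → DifferenceOfPermutations G A
hall {zero}  G A _ = record { β = id ; γ = id ; β-injective = id ; γ-injective = id ; β≡γ+A = λ () }
hall {suc m} G A   =
  HallInduction.hall-vanishing G m ℕ.≤-refl A (λ i m≤i → ⊥-elim (ℕ.<⇒≱ (toℕ<n i) m≤i))

-- Diagonals of the extension

tabulate-inject≤-++ : ∀ {A : Set} {d s} (u : Vec A d) (v : Vec A s) (d≤d+s : d ≤ d ℕ.+ s) →
                      Vec.tabulate (λ i → lookup (u ++ v) (inject≤ i d≤d+s)) ≡ u
tabulate-inject≤-++ []      v _             = refl
tabulate-inject≤-++ (x ∷ u) v (ℕ.s≤s d≤d+s) = cong (x ∷_) (tabulate-inject≤-++ u v d≤d+s)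

drop-toList-++ : ∀ {A : Set} {d s} (u : Vec A d) (v : Vec A s) → List.drop d (toList (u ++ v)) ≡ toList v
drop-toList-++ []      v = refl
drop-toList-++ (x ∷ u) v = drop-toList-++ u v

module _ {n} (G : FinAbGroup n) where
  open FinAbGroupProperties G

  zipWith-+-cancelʳ : ∀ {s} {u u′ : Vec (Fin n) s} (v : Vec (Fin n) s) →
                      zipWith _+_ u v ≡ zipWith _+_ u′ v → u ≡ u′
  zipWith-+-cancelʳ {u = []}    {[]}      []      _  = refl
  zipWith-+-cancelʳ {u = x ∷ u} {x′ ∷ u′} (y ∷ v) eq =
    cong₂ _∷_ (∙-cancelʳ y _ _ (Vec.∷-injectiveˡ eq)) (zipWith-+-cancelʳ v (Vec.∷-injectiveʳ eq))

  zipWith-+-unique : ∀ {s} (u w : Vec (Fin n) s) → ∃! _≡_ (λ v → zipWith _+_ u v ≡ w)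
  zipWith-+-unique []      []      = [] , refl , λ { {[]} _ → refl }
  zipWith-+-unique (x ∷ u) (y ∷ w) with zipWith-+-unique u w
  ... | v , u+v≡w , v-unique =
        (- x + y) ∷ v , cong₂ _∷_ (\\-leftDividesˡ x y) u+v≡w ,
        λ { {z ∷ v′} eq →
              cong₂ _∷_ (∙-cancelˡ x _ _ (trans (\\-leftDividesˡ x y) (sym (Vec.∷-injectiveˡ eq))))
                        (v-unique (Vec.∷-injectiveʳ eq)) }

  _++ᴰ_ : ∀ {d s} → Diagonal G d → Diagonal G s → Diagonal G (d ℕ.+ s)
  _++ᴰ_ {d} D W = record
    { pos      = λ k → pos D k ++ pos W k
    ; distinct = λ eq → distinct D (Vec.++-injectiveˡ _ _ eq)
    ; coordInj = coordinate-injective }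
    where
    coordinate-injective : ∀ i → Injective _≡_ _≡_ (λ k → lookup (pos D k ++ pos W k) i)
    coordinate-injective i {k} {k′} eq = by-block (Fin.splitAt d i)
      (trans (sym (Vec.lookup-splitAt d (pos D k) (pos W k) i))
             (trans eq (Vec.lookup-splitAt d (pos D k′) (pos W k′) i)))
      where
      by-block : ∀ b → [ lookup (pos D k) , lookup (pos W k) ]′ b
                     ≡ [ lookup (pos D k′) , lookup (pos W k′) ]′ b → k ≡ k′
      by-block (inj₁ i) = coordInj D i
      by-block (inj₂ i) = coordInj W i

  translate : ∀ {s} → Diagonal G s → Vec (Fin n) s → Diagonal G s
  translate W v = record
    { pos      = λ k → zipWith _+_ (pos W k) v
    ; distinct = λ eq → distinct W (zipWith-+-cancelʳ v eq)
    ; coordInj = λ i {k} {k′} eq → coordInj W i (∙-cancelʳ (lookup v i) _ _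
        (trans (sym (Vec.lookup-zipWith _+_ i (pos W k) v))
               (trans eq (Vec.lookup-zipWith _+_ i (pos W k′) v)))) }

  IsPartitionBy : ∀ {d} {I : Set} → (I → Diagonal G d) → Set
  IsPartitionBy {d} {I} Ds = ∀ (x : Pos G d) → ∃! _≡_ (λ (j : I) → ∃ λ k → pos (Ds j) k ≡ x)

  IsPartitionBy-reindex : ∀ {d m} {I : Set} (e : Fin m ↔ I) {Ds : I → Diagonal G d} →
                          IsPartitionBy Ds → IsPartition G (Ds ∘ Inverse.to e)
  IsPartitionBy-reindex e {Ds} partition x with partition x
  ... | t , (k , hit) , unique =
        from t , (k , subst (λ t → pos (Ds t) k ≡ x) (sym (strictlyInverseˡ t)) hit) ,
        λ {i} hit′ → trans (cong from (unique hit′)) (strictlyInverseʳ i)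
    where open Inverse e

  ++ᴰ-translate-partition :
    ∀ {d s} {I : Set} {Ds : I → Diagonal G d} → IsPartitionBy Ds → (Ws : I → Diagonal G s) →
    IsPartitionBy (λ (t : I × Vec (Fin n) s) → Ds (proj₁ t) ++ᴰ translate (Ws (proj₁ t)) (proj₂ t))
  ++ᴰ-translate-partition {d} {Ds = Ds} Ds-partition Ws x with Vec.splitAt d x
  ... | u , w , refl with Ds-partition u
  ... | j , (k , Dk≡u) , j-unique with zipWith-+-unique (pos (Ws j) k) w
  ... | v , Wk+v≡w , v-unique = (j , v) , (k , cong₂ _++_ Dk≡u Wk+v≡w) , unique
    where
    unique : ∀ {t} →
             (∃ λ k′ → pos (Ds (proj₁ t)) k′ ++ zipWith _+_ (pos (Ws (proj₁ t)) k′) (proj₂ t) ≡ u ++ w) →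
             (j , v) ≡ t
    unique {j′ , v′} (k′ , eq) with Vec.++-injective (pos (Ds j′) k′) u eq
    ... | D′k′≡u , W′k′+v′≡w with j-unique (k′ , D′k′≡u)
    ... | refl with distinct (Ds j) (trans D′k′≡u (sym Dk≡u))
    ... | refl = cong (j ,_) (v-unique W′k′+v′≡w)

  indexing : ∀ M s → Fin (M ℕ.* n ^ s) ↔ (Fin M × Vec (Fin n) s)
  indexing M s = ↔-trans *↔× (↔-refl ×-↔ ↔-trans (Fin[m^n]↔Fin[m]^n n s) (↔Vec s))

  module _ {d s} (d≤d+s : d ≤ d ℕ.+ s) (L : Hypercube G d) where
    open ≡-Reasoning

    extension-++ : ∀ u v → extension G d≤d+s L (u ++ v) ≡ L u + ΣG G (toList v)
    extension-++ u v = cong₂ (λ x y → L x + ΣG G y) (tabulate-inject≤-++ u v d≤d+s) (drop-toList-++ u v)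

    translate-transversal : ∀ (D : Diagonal G d) (W : Diagonal G s) →
                            IsTransversal G (extension G d≤d+s L) (D ++ᴰ W) →
                            ∀ v → IsTransversal G (extension G d≤d+s L) (D ++ᴰ translate W v)
    translate-transversal D W transversal v {k} {k′} eq =
      transversal (∙-cancelʳ (ΣG G (toList v)) _ _ (trans (sym (shift k)) (trans eq (shift k′))))
      where
      shift : ∀ k → extension G d≤d+s L (pos D k ++ zipWith _+_ (pos W k) v)
                    ≡ extension G d≤d+s L (pos D k ++ pos W k) + ΣG G (toList v)
      shift k = begin
        extension G d≤d+s L (pos D k ++ zipWith _+_ (pos W k) v)
          ≡⟨ extension-++ _ _ ⟩
        L (pos D k) + ΣG G (toList (zipWith _+_ (pos W k) v))
          ≡⟨ cong (L (pos D k) +_) (ΣG-zipWith (pos W k) v) ⟩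
        L (pos D k) + (ΣG G (toList (pos W k)) + ΣG G (toList v))
          ≡⟨ assoc _ _ _ ⟨
        L (pos D k) + ΣG G (toList (pos W k)) + ΣG G (toList v)
          ≡⟨ cong (_+ ΣG G (toList v)) (extension-++ _ _) ⟨
        extension G d≤d+s L (pos D k ++ pos W k) + ΣG G (toList v)
          ∎

  replicate-coordinate-injective : ∀ {e} i →
                                   Injective _≡_ _≡_ (λ (k : Fin n) → lookup (replicate e k) i)
  replicate-coordinate-injective i {k} {k′} eq =
    trans (sym (Vec.lookup-replicate i k)) (trans eq (Vec.lookup-replicate i k′))

  module _ {d e} (d≤d+1+e : d ≤ d ℕ.+ suc e) (L : Hypercube G d) (D : Diagonal G d) where
    open ≡-Reasoning

    σ ρ a : Fin n → Fin n
    σ k = L (pos D k)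
    ρ k = ΣG G (toList (replicate e k))
    a k = σ k + ρ k

    sum-σ : IsSuitable G (d ℕ.+ suc e) L D → sum σ ≡ - ((d ℕ.+ e) ×ᴳ G₊ G) + d ×ᴳ G₊ G
    sum-σ suitable = begin
      sum σ
        ≡⟨ sum-cong-≗ (λ k → //-rightDividesˡ (ΣG G (toList (pos D k))) (σ k)) ⟨
      sum (λ k → Δ G (pos D k) (σ k) + ΣG G (toList (pos D k)))
        ≡⟨ ∑-distrib-+ (λ k → Δ G (pos D k) (σ k)) (λ k → ΣG G (toList (pos D k))) ⟩
      sum (λ k → Δ G (pos D k) (σ k)) + sum (λ k → ΣG G (toList (pos D k)))
        ≡⟨ cong₂ _+_ (trans (sym (ΣG-tabulate (λ k → Δ G (pos D k) (σ k)))) suitable)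
                     (sum-coordinateSums (pos D) (coordInj D)) ⟩
      - (_·_ G (d ℕ.+ suc e ℕ.∸ 1) (G₊ G)) + d ×ᴳ G₊ G
        ≡⟨ cong (λ c → - c + d ×ᴳ G₊ G) (trans (cong (λ t → _·_ G (t ℕ.∸ 1) (G₊ G)) (ℕ.+-suc d e))
                                                (·≗×ᴳ (d ℕ.+ e) (G₊ G))) ⟩
      - ((d ℕ.+ e) ×ᴳ G₊ G) + d ×ᴳ G₊ G
        ∎

    sum-a : IsSuitable G (d ℕ.+ suc e) L D → sum a ≡ ε
    sum-a suitable = begin
      sum a
        ≡⟨ ∑-distrib-+ σ ρ ⟩
      sum σ + sum ρ
        ≡⟨ cong₂ _+_ (sum-σ suitable) (sum-coordinateSums (replicate e) replicate-coordinate-injective) ⟩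
      - ((d ℕ.+ e) ×ᴳ G₊ G) + d ×ᴳ G₊ G + e ×ᴳ G₊ G
        ≡⟨ assoc _ _ _ ⟩
      - ((d ℕ.+ e) ×ᴳ G₊ G) + (d ×ᴳ G₊ G + e ×ᴳ G₊ G)
        ≡⟨ cong (- ((d ℕ.+ e) ×ᴳ G₊ G) +_) (×-homo-+ (G₊ G) d e) ⟨
      - ((d ℕ.+ e) ×ᴳ G₊ G) + (d ℕ.+ e) ×ᴳ G₊ G
        ≡⟨ inverseˡ _ ⟩
      ε
        ∎

    suitable-extends-to-transversal : IsSuitable G (d ℕ.+ suc e) L D →
      ∃ λ (W : Diagonal G (suc e)) → IsTransversal G (extension G d≤d+1+e L) (D ++ᴰ W)
    suitable-extends-to-transversal suitable =
      W , λ eq → β-injective (trans (sym (symbol _)) (trans eq (symbol _)))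
      where
      open DifferenceOfPermutations (hall G a (sum-a suitable))
      W : Diagonal G (suc e)
      W = record
        { pos      = λ k → γ k ∷ replicate e k
        ; distinct = λ eq → γ-injective (Vec.∷-injectiveˡ eq)
        ; coordInj = λ { zero eq → γ-injective eq ; (suc i) → replicate-coordinate-injective i } }
      symbol : ∀ k → extension G d≤d+1+e L (pos D k ++ pos W k) ≡ β k
      symbol k = begin
        extension G d≤d+1+e L (pos D k ++ pos W k)  ≡⟨ extension-++ d≤d+1+e L _ _ ⟩
        σ k + (γ k + ρ k)                           ≡⟨ solve 3 (λ x y z → x ⊕ (y ⊕ z) ⊜ y ⊕ (x ⊕ z))
                                                               refl (σ k) (γ k) (ρ k) ⟩
        γ k + a k                                   ≡⟨ β≡γ+A k ⟨
        β k                                         ∎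

<⇒∃[e]m+suc[e]≡n : ∀ {m n} → m < n → ∃ λ e → m ℕ.+ suc e ≡ n
<⇒∃[e]m+suc[e]≡n {m} m<n with e , 1+m+e≡n ← ℕ.m≤n⇒∃[o]m+o≡n m<n =
  e , trans (ℕ.+-suc m e) 1+m+e≡n

corollary3p5 : ∀ {n : ℕ} (G : FinAbGroup n) (d d' : ℕ) (d<d' : d < d')
                 (L : Hypercube G d) → IsLatin G L →
                 (∃[ m ] ∃ λ (Ds : Fin m → Diagonal G d) →
                    IsPartition G Ds × (∀ j → IsSuitable G d' L (Ds j))) →
                 ∃[ m ] ∃ λ (Ts : Fin m → Diagonal G d') →
                    IsPartition G Ts × (∀ j → IsTransversal G (extension G (<⇒≤ d<d') L) (Ts j))
corollary3p5 {n} G d d' d<d' L _ (M , Ds , Ds-partition , Ds-suitable)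
  with e , refl ← <⇒∃[e]m+suc[e]≡n d<d' =
  M ℕ.* n ^ suc e , lifted ∘ Inverse.to index ,
  IsPartitionBy-reindex G index {lifted} (++ᴰ-translate-partition G {Ds = Ds} Ds-partition Ws) ,
  lifted-transversal ∘ Inverse.to index
  where
  L′ = extension G (<⇒≤ d<d') L
  index = indexing G M (suc e)

  extends : ∀ j → ∃ λ W → IsTransversal G L′ (_++ᴰ_ G (Ds j) W)
  extends j = suitable-extends-to-transversal G (<⇒≤ d<d') L (Ds j) (Ds-suitable j)

  Ws : Fin M → Diagonal G (suc e)
  Ws = proj₁ ∘ extends

  lifted : Fin M × Vec (Fin n) (suc e) → Diagonal G (d ℕ.+ suc e)
  lifted (j , v) = _++ᴰ_ G (Ds j) (translate G (Ws j) v)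

  lifted-transversal : ∀ t → IsTransversal G L′ (lifted t)
  lifted-transversal (j , v) = translate-transversal G (<⇒≤ d<d') L (Ds j) (Ws j) (proj₂ (extends j)) v
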